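{- Let $A\in\mathbb Z_3$ be written as $A=\sum_{i\ge0}a_i3^i=\sum_{j\ge0}b_j3^j$ with $a_i\in\{0,\pm1\}$ and $b_j\in\{0,1,2\}$. Then for all $t\ge0$, $$b_t\equiv a_t+\sum_{0\le\lambda<t}a_\lambda(a_\lambda-1)\prod_{\lambda<i<t}(1-a_i^2)\pmod3,$$ $$a_t\equiv b_t+\sum_{0\le\lambda<t}b_\lambda(1-b_\lambda)\prod_{\lambda<i<t}b_i(2-b_i)\pmod3.$$
   Context: Empty products equal $1$ and empty sums equal $0$. -}

module Defs where

open import Data.Nat using (ℕ; zero; suc; _∸_)
import Data.Nat as ℕ
open import Data.Integer using (ℤ; +_; -_; _+_; _-_; _*_; _^_; _≤_)
open import Data.Integer.Divisibility using (_∣_)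
open import Data.Product using (_×_)
open import Data.Sum using (_⊎_)
open import Relation.Binary.PropositionalEquality using (_≡_)

_≡_[mod_] : ℤ → ℤ → ℤ → Set
x ≡ y [mod m ] = m ∣ (x - y)

sumBelow : ℕ → (ℕ → ℤ) → ℤ
sumBelow zero    f = + 0
sumBelow (suc n) f = sumBelow n f + f n

prodBetween : ℕ → ℕ → (ℕ → ℤ) → ℤ
prodBetween l t f = go (t ∸ suc l)
  where
  go : ℕ → ℤ
  go zero    = + 1
  go (suc k) = go k * f (suc l ℕ.+ k)

IsBalancedDigit : ℤ → Set
IsBalancedDigit a = a ≡ - (+ 1) ⊎ a ≡ + 0 ⊎ a ≡ + 1

IsStdDigit : ℤ → Set
IsStdDigit b = (+ 0 ≤ b) × (b ≤ + 2)

-- Two digit sequences represent the same 3-adic integer: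
-- ∑ a_i 3^i = ∑ b_i 3^i in ℤ_3 = lim ℤ/3^n, i.e. all truncations agree mod 3^n.
Same3Adic : (ℕ → ℤ) → (ℕ → ℤ) → Set
Same3Adic a b = ∀ n →
  sumBelow n (λ i → a i * (+ 3) ^ i) ≡ sumBelow n (λ i → b i * (+ 3) ^ i) [mod (+ 3) ^ n ]

-- Let A_t and B_t be the partial sums of the two expansions below 3^t. Since they agree modulo 3^t,
-- B_t - A_t = c_t 3^t for an integer carry c_t, with c_0 = 0 and c_t + b_t - a_t = 3 c_(t+1); digit by
-- digit this forces c_t ∈ {0, 1}, b_t ≡ a_t - c_t and a_t ≡ b_t + c_t (mod 3). The two sums of the
-- theorem satisfy the Horner recurrences S_(t+1) = S_t f_t + g_t, and an exhaustive check of the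
-- digit/carry combinations shows that modulo 3 these are the recurrences of -c_t and of c_t.

module Submission where

open import Defs
open import Data.Nat using (ℕ)
open import Data.Integer using (ℤ; +_; _+_; _-_; _*_)
open import Data.Product using (_×_)

open import Data.Nat using (zero; suc)
import Data.Nat as ℕ
import Data.Nat.Properties as ℕ
open import Data.Integer using (-_; _^_; 0ℤ; 1ℤ; NonZero; ≢-nonZero; +≤+)
open import Data.Integer.Properties
  using (_≟_; *-assoc; *-zeroˡ; *-identityʳ; *-distribʳ-+; *-cancelʳ-≡; i^n≡0⇒i≡0)
open import Data.Integer.Divisibility.Signed
  using (_∣_; divides; ∣ᵤ⇒∣; ∣⇒∣ᵤ; _∣?_; ∣m⇒∣-m; ∣m⇒∣m*n; ∣m∣n⇒∣m+n)
open import Data.Integer.Tactic.RingSolver using (solve-∀)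
open import Data.List using (List; []; _∷_)
open import Data.List.Membership.Propositional using (_∈_; find)
open import Data.List.Relation.Unary.All as All using (All; all?)
open import Data.List.Relation.Unary.Any using (Any; any?; here; there)
open import Data.Product using (_,_)
open import Data.Sum using (inj₁; inj₂)
open import Function using (case_of_)
open import Relation.Nullary.Decidable using (Dec; map′; _×-dec_; _→-dec_; from-yes)
open import Relation.Binary.PropositionalEquality
  using (_≡_; refl; sym; trans; cong; cong₂; subst; module ≡-Reasoning)

prodBetween-empty : ∀ t f → prodBetween t (suc t) f ≡ 1ℤ
prodBetween-empty t f rewrite ℕ.n∸n≡0 t = refl

prodBetween-snoc : ∀ {l t} f → l ℕ.< t → prodBetween l (suc t) f ≡ prodBetween l t f * f t
prodBetween-snoc {l} {t} f l<t rewrite ℕ.+-∸-assoc 1 l<t =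
  cong (λ i → prodBetween l t f * f i) (ℕ.m+[n∸m]≡n l<t)

sumBelow-cong : ∀ n {f g : ℕ → ℤ} → (∀ {l} → l ℕ.< n → f l ≡ g l) → sumBelow n f ≡ sumBelow n g
sumBelow-cong zero    f≡g = refl
sumBelow-cong (suc n) f≡g =
  cong₂ _+_ (sumBelow-cong n (λ l<n → f≡g (ℕ.m<n⇒m<1+n l<n))) (f≡g (ℕ.n<1+n n))

sumBelow-*ʳ : ∀ n f c → sumBelow n (λ l → f l * c) ≡ sumBelow n f * c
sumBelow-*ʳ zero    f c = sym (*-zeroˡ c)
sumBelow-*ʳ (suc n) f c =
  trans (cong (_+ f n * c) (sumBelow-*ʳ n f c)) (sym (*-distribʳ-+ c (sumBelow n f) (f n)))

weightedProductSum : (ℕ → ℤ) → (ℕ → ℤ) → ℕ → ℤ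
weightedProductSum g f t = sumBelow t (λ l → g l * prodBetween l t f)

weightedProductSum-suc : ∀ g f n →
  weightedProductSum g f (suc n) ≡ weightedProductSum g f n * f n + g n
weightedProductSum-suc g f n = cong₂ _+_ earlier-terms last-term
  where
  open ≡-Reasoning
  earlier-terms : sumBelow n (λ l → g l * prodBetween l (suc n) f) ≡ weightedProductSum g f n * f n
  earlier-terms = begin
    sumBelow n (λ l → g l * prodBetween l (suc n) f)
      ≡⟨ sumBelow-cong n (λ l<n → trans (cong (g _ *_) (prodBetween-snoc f l<n)) (sym (*-assoc (g _) _ (f n)))) ⟩
    sumBelow n (λ l → g l * prodBetween l n f * f n)
      ≡⟨ sumBelow-*ʳ n (λ l → g l * prodBetween l n f) (f n) ⟩
    weightedProductSum g f n * f n ∎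
  last-term : g n * prodBetween n (suc n) f ≡ g n
  last-term = trans (cong (g n *_) (prodBetween-empty n f)) (*-identityʳ (g n))

-- Unlike _≡_[mod_], which unfolds to a statement about ∣ x - y ∣, this record keeps x, y and m
-- recoverable by unification.
record _≈_[mod_] (x y m : ℤ) : Set where
  constructor ⟨_⟩
  field divisible : m ∣ x - y

infix 4 _≈_[mod_]

module _ {m : ℤ} where

  ≡mod⇒≈ : ∀ x y → x ≡ y [mod m ] → x ≈ y [mod m ]
  ≡mod⇒≈ x y x≡y = ⟨ ∣ᵤ⇒∣ {m} {x - y} x≡y ⟩

  ≈⇒≡mod : ∀ {x y} → x ≈ y [mod m ] → x ≡ y [mod m ]
  ≈⇒≡mod {x} {y} ⟨ m∣x-y ⟩ = ∣⇒∣ᵤ {m} {x - y} m∣x-y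

  multiple⇒≈ : ∀ {x y} k → x - y ≡ k * m → x ≈ y [mod m ]
  multiple⇒≈ k eq = ⟨ divides k eq ⟩

  ≈-sym : ∀ {x y} → x ≈ y [mod m ] → y ≈ x [mod m ]
  ≈-sym {x} {y} ⟨ m∣x-y ⟩ = ⟨ subst (m ∣_) (swap x y) (∣m⇒∣-m m∣x-y) ⟩
    where
    swap : ∀ x y → - (x - y) ≡ y - x
    swap = solve-∀

  ≈-trans : ∀ {x y z} → x ≈ y [mod m ] → y ≈ z [mod m ] → x ≈ z [mod m ]
  ≈-trans {x} {y} {z} ⟨ m∣x-y ⟩ ⟨ m∣y-z ⟩ = ⟨ subst (m ∣_) (split x y z) (∣m∣n⇒∣m+n m∣x-y m∣y-z) ⟩
    where
    split : ∀ x y z → (x - y) + (y - z) ≡ x - z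
    split = solve-∀

  ≈-*-+-cong : ∀ {x y} f g → x ≈ y [mod m ] → x * f + g ≈ y * f + g [mod m ]
  ≈-*-+-cong {x} {y} f g ⟨ m∣x-y ⟩ = ⟨ subst (m ∣_) (factor x y f g) (∣m⇒∣m*n f m∣x-y) ⟩
    where
    factor : ∀ x y f g → (x - y) * f ≡ (x * f + g) - (y * f + g)
    factor = solve-∀

  ≈-+-congˡ : ∀ {x y} z → x ≈ y [mod m ] → z + x ≈ z + y [mod m ]
  ≈-+-congˡ {x} {y} z ⟨ m∣x-y ⟩ = ⟨ subst (m ∣_) (shift x y z) m∣x-y ⟩
    where
    shift : ∀ x y z → x - y ≡ (z + x) - (z + y)
    shift = solve-∀

nonZero-3^ : ∀ n → NonZero ((+ 3) ^ n)
nonZero-3^ n = ≢-nonZero λ 3^n≡0 → case i^n≡0⇒i≡0 (+ 3) n 3^n≡0 of λ ()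

partialValue : (ℕ → ℤ) → ℕ → ℤ
partialValue d n = sumBelow n (λ i → d i * (+ 3) ^ i)

-- A and B are partial values below P = 3ⁿ, c and c' the carries into positions n and n + 1.
carry-recurrence : ∀ {A B a b c c' P} .{{_ : NonZero P}} →
  B - A ≡ c * P → (B + b * P) - (A + a * P) ≡ c' * (+ 3 * P) → c + b - a ≡ c' * + 3
carry-recurrence {A} {B} {a} {b} {c} {c'} {P} spec spec' = *-cancelʳ-≡ _ _ P (begin
  (c + b - a) * P                 ≡⟨ expand c b a P ⟩
  c * P + (b * P - a * P)         ≡⟨ cong (_+ (b * P - a * P)) (sym spec) ⟩
  (B - A) + (b * P - a * P)       ≡⟨ regroup A B a b P ⟩
  (B + b * P) - (A + a * P)       ≡⟨ spec' ⟩
  c' * (+ 3 * P)                  ≡⟨ sym (*-assoc c' (+ 3) P) ⟩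
  c' * + 3 * P                    ∎)
  where
  open ≡-Reasoning
  expand : ∀ c b a P → (c + b - a) * P ≡ c * P + (b * P - a * P)
  expand = solve-∀
  regroup : ∀ A B a b P → (B - A) + (b * P - a * P) ≡ (B + b * P) - (A + a * P)
  regroup = solve-∀

standard-digit-≈ : ∀ a b c c' → c + b - a ≡ c' * + 3 → b ≈ a + - c [mod + 3 ]
standard-digit-≈ a b c c' eq = multiple⇒≈ c' (trans (rearrange a b c) eq)
  where
  rearrange : ∀ a b c → b - (a + - c) ≡ c + b - a
  rearrange = solve-∀

balanced-digit-≈ : ∀ a b c c' → c + b - a ≡ c' * + 3 → a ≈ b + c [mod + 3 ]
balanced-digit-≈ a b c c' eq = multiple⇒≈ (- c') (begin
  a - (b + c)      ≡⟨ rearrange a b c ⟩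
  - (c + b - a)    ≡⟨ cong -_ eq ⟩
  - (c' * + 3)     ≡⟨ neg-* c' (+ 3) ⟩
  - c' * + 3       ∎)
  where
  open ≡-Reasoning
  rearrange : ∀ a b c → a - (b + c) ≡ - (c + b - a)
  rearrange = solve-∀
  neg-* : ∀ x y → - (x * y) ≡ - x * y
  neg-* = solve-∀

module Carry {a b : ℕ → ℤ} (same : Same3Adic a b) where

  3^n∣difference : ∀ n → (+ 3) ^ n ∣ partialValue b n - partialValue a n
  3^n∣difference n =
    _≈_[mod_].divisible (≈-sym (≡mod⇒≈ (partialValue a n) (partialValue b n) (same n)))

  carry : ℕ → ℤ
  carry n = _∣_.quotient (3^n∣difference n)

  carry-spec : ∀ n → partialValue b n - partialValue a n ≡ carry n * (+ 3) ^ n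
  carry-spec n = _∣_.equality (3^n∣difference n)

  carry-zero : carry 0 ≡ 0ℤ
  carry-zero = trans (sym (*-identityʳ (carry 0))) (sym (carry-spec 0))

  carry-suc : ∀ n → carry n + b n - a n ≡ carry (suc n) * + 3
  carry-suc n = carry-recurrence {partialValue a n} {partialValue b n} {a n} {b n} {carry n}
    {carry (suc n)} {(+ 3) ^ n} {{nonZero-3^ n}} (carry-spec n) (carry-spec (suc n))

  standard-digit-≈-carry : ∀ n → b n ≈ a n + - carry n [mod + 3 ]
  standard-digit-≈-carry n = standard-digit-≈ (a n) (b n) (carry n) (carry (suc n)) (carry-suc n)

  balanced-digit-≈-carry : ∀ n → a n ≈ b n + carry n [mod + 3 ]
  balanced-digit-≈-carry n = balanced-digit-≈ (a n) (b n) (carry n) (carry (suc n)) (carry-suc n)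

balancedDigits standardDigits carries : List ℤ
balancedDigits = - + 1 ∷ + 0 ∷ + 1 ∷ []
standardDigits = + 0 ∷ + 1 ∷ + 2 ∷ []
carries        = + 0 ∷ + 1 ∷ []

balanced-∈ : ∀ {a} → IsBalancedDigit a → a ∈ balancedDigits
balanced-∈ (inj₁ refl)        = here refl
balanced-∈ (inj₂ (inj₁ refl)) = there (here refl)
balanced-∈ (inj₂ (inj₂ refl)) = there (there (here refl))

standard-∈ : ∀ {b} → IsStdDigit b → b ∈ standardDigits
standard-∈ (+≤+ ℕ.z≤n , +≤+ ℕ.z≤n)                     = here refl
standard-∈ (+≤+ ℕ.z≤n , +≤+ (ℕ.s≤s ℕ.z≤n))             = there (here refl)
standard-∈ (+≤+ ℕ.z≤n , +≤+ (ℕ.s≤s (ℕ.s≤s ℕ.z≤n)))     = there (there (here refl))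

≈-mod-3? : ∀ x y → Dec (x ≈ y [mod + 3 ])
≈-mod-3? x y = map′ ⟨_⟩ _≈_[mod_].divisible (+ 3 ∣? x - y)

CarryCongruences : ℤ → ℤ → ℤ → ℤ → Set
CarryCongruences a b c c' =
  (- c' ≈ - c * (+ 1 - a * a) + a * (a - + 1) [mod + 3 ]) ×
  (c' ≈ c * (b * (+ 2 - b)) + b * (+ 1 - b) [mod + 3 ])

DigitStep : ℤ → ℤ → ℤ → Set
DigitStep a b c =
  + 3 ∣ c + b - a → Any (λ c' → (c + b - a ≡ c' * + 3) × CarryCongruences a b c c') carries

digit-step? : ∀ a b c → Dec (DigitStep a b c)
digit-step? a b c = + 3 ∣? c + b - a →-dec any? (λ c' →
  c + b - a ≟ c' * + 3 ×-dec
  ≈-mod-3? (- c') (- c * (+ 1 - a * a) + a * (a - + 1)) ×-dec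
  ≈-mod-3? c' (c * (b * (+ 2 - b)) + b * (+ 1 - b))) carries

digit-table : All (λ a → All (λ b → All (DigitStep a b) carries) standardDigits) balancedDigits
digit-table =
  from-yes (all? (λ a → all? (λ b → all? (digit-step? a b) carries) standardDigits) balancedDigits)

digit-step : ∀ {a b c c'} → IsBalancedDigit a → IsStdDigit b → c ∈ carries →
  c + b - a ≡ c' * + 3 → c' ∈ carries × CarryCongruences a b c c'
digit-step {a} {b} {c} {c'} a-digit b-digit c-carry eq =
  let d , d-carry , eq′ , congruences = find (entry (divides c' eq))
  in subst (λ x → x ∈ carries × CarryCongruences a b c x)
       (*-cancelʳ-≡ d c' (+ 3) (trans (sym eq′) eq)) (d-carry , congruences)
  where
  entry : DigitStep a b c
  entry = All.lookup (All.lookup (All.lookup digit-table (balanced-∈ a-digit)) (standard-∈ b-digit)) c-carry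

balancedCarrySum : (ℕ → ℤ) → ℕ → ℤ
balancedCarrySum a = weightedProductSum (λ l → a l * (a l - + 1)) (λ i → + 1 - a i * a i)

standardCarrySum : (ℕ → ℤ) → ℕ → ℤ
standardCarrySum b = weightedProductSum (λ l → b l * (+ 1 - b l)) (λ i → b i * (+ 2 - b i))

balancedCarrySum-suc : ∀ a n →
  balancedCarrySum a (suc n) ≡ balancedCarrySum a n * (+ 1 - a n * a n) + a n * (a n - + 1)
balancedCarrySum-suc a = weightedProductSum-suc (λ l → a l * (a l - + 1)) (λ i → + 1 - a i * a i)

standardCarrySum-suc : ∀ b n →
  standardCarrySum b (suc n) ≡ standardCarrySum b n * (b n * (+ 2 - b n)) + b n * (+ 1 - b n)
standardCarrySum-suc b = weightedProductSum-suc (λ l → b l * (+ 1 - b l)) (λ i → b i * (+ 2 - b i))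

module _ {a b : ℕ → ℤ} (a-digits : ∀ i → IsBalancedDigit (a i)) (b-digits : ∀ j → IsStdDigit (b j))
         (same : Same3Adic a b) where
  open Carry {a} {b} same

  carry-invariant : ∀ n → carry n ∈ carries ×
    (- carry n ≈ balancedCarrySum a n [mod + 3 ]) × (carry n ≈ standardCarrySum b n [mod + 3 ])
  carry-invariant zero rewrite carry-zero = here refl , multiple⇒≈ 0ℤ refl , multiple⇒≈ 0ℤ refl
  carry-invariant (suc n) =
    let c-carry  , −c≈Sa , c≈Sb = carry-invariant n
        c'-carry , −c'≈  , c'≈  = digit-step (a-digits n) (b-digits n) c-carry (carry-suc n)
    in c'-carry ,
       subst (λ S → - carry (suc n) ≈ S [mod + 3 ]) (sym (balancedCarrySum-suc a n))
         (≈-trans −c'≈ (≈-*-+-cong _ _ −c≈Sa)) ,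
       subst (λ S → carry (suc n) ≈ S [mod + 3 ]) (sym (standardCarrySum-suc b n))
         (≈-trans c'≈ (≈-*-+-cong _ _ c≈Sb))

corollary5p2 : (a b : ℕ → ℤ) → (∀ i → IsBalancedDigit (a i)) → (∀ j → IsStdDigit (b j)) → Same3Adic a b → (t : ℕ) → (b t ≡ a t + sumBelow t (λ l → a l * (a l - + 1) * prodBetween l t (λ i → + 1 - a i * a i)) [mod + 3 ]) × (a t ≡ b t + sumBelow t (λ l → b l * (+ 1 - b l) * prodBetween l t (λ i → b i * (+ 2 - b i))) [mod + 3 ])
corollary5p2 a b a-digits b-digits same t =
  let _ , −c≈Sa , c≈Sb = carry-invariant a-digits b-digits same t
  in ≈⇒≡mod (≈-trans (standard-digit-≈-carry t) (≈-+-congˡ (a t) −c≈Sa)) ,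
     ≈⇒≡mod (≈-trans (balanced-digit-≈-carry t) (≈-+-congˡ (b t) c≈Sb))
  where open Carry {a} {b} same
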